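{- Let $\delta=10\in\mathbb{F}_{17}$ and let $\alpha\in\mathbb{F}_{17^2}$ be a root of $x^2-\delta$. Let $H=\{1,4,16,13\}$ and $C_{17}^C=\{0\}\cup H\cup(\alpha+7)\{1,4\}\cup(\alpha+10)\{1,4\}$. Then the setwise stabilizer of $C_{17}^C$ in $\mathrm{Aut}(P(17^2))$ is $\langle\phi'\rangle\cong\mathbb{Z}_2$, where $\phi'(\gamma)=16\gamma^{17}$ for all $\gamma\in\mathbb{F}_{17^2}$. Moreover, the orbit of $C_{17}^C$ under $\mathrm{Aut}(P(17^2))$ has size $41616$.
   Context: The Paley graph $P(17^2)$ has vertex set $\mathbb{F}_{17^2}$, two distinct vertices adjacent iff their difference is a nonzero square. $\mathrm{Aut}(P(17^2))=\{\gamma\mapsto a\gamma^{v}+b : a \text{ a nonzero square of } \mathbb{F}_{17^2},\ b\in\mathbb{F}_{17^2},\ v\in\mathrm{Gal}(\mathbb{F}_{17^2})\}$, acting on subsets elementwise. Elements of $\mathbb{F}_{17}$ are written as integers mod $17$. -}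

module Defs where

open import Data.Nat as ℕ using (ℕ; zero; suc)
open import Data.Nat.DivMod using (_mod_)
open import Data.Fin using (Fin; toℕ)
open import Data.Bool using (Bool; true; false)
open import Data.Product using (_×_; _,_; Σ; ∃; ∃-syntax)
open import Data.List using (List; []; _∷_)
open import Data.List.Membership.Propositional using (_∈_)
open import Relation.Binary.PropositionalEquality using (_≡_; _≢_)
open import Relation.Unary using (Pred)
open import Level using (0ℓ)

F17 : Set
F17 = Fin 17

infixl 6 _+₁₇_
infixl 7 _*₁₇_

_+₁₇_ : F17 → F17 → F17
x +₁₇ y = (toℕ x ℕ.+ toℕ y) mod 17

_*₁₇_ : F17 → F17 → F17
x *₁₇ y = (toℕ x ℕ.* toℕ y) mod 17

⟨_⟩ : ℕ → F17
⟨ n ⟩ = n mod 17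

δ : F17
δ = ⟨ 10 ⟩

-- 𝔽₁₇² = 𝔽₁₇[α]/(α² − δ), δ = 10 (a non-square mod 17).
-- The pair (x , y) represents x + y·α.

F : Set
F = F17 × F17

embed : F17 → F
embed x = x , ⟨ 0 ⟩

0F 1F α : F
0F = embed ⟨ 0 ⟩
1F = embed ⟨ 1 ⟩
α  = ⟨ 0 ⟩ , ⟨ 1 ⟩

infixl 6 _+F_
infixl 7 _*F_

_+F_ : F → F → F
(x₁ , y₁) +F (x₂ , y₂) = (x₁ +₁₇ x₂) , (y₁ +₁₇ y₂)

_*F_ : F → F → F
(x₁ , y₁) *F (x₂ , y₂) =
  (x₁ *₁₇ x₂ +₁₇ δ *₁₇ (y₁ *₁₇ y₂)) , (x₁ *₁₇ y₂ +₁₇ y₁ *₁₇ x₂)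

infixr 8 _^F_
_^F_ : F → ℕ → F
γ ^F zero  = 1F
γ ^F suc n = γ *F (γ ^F n)

galois : Bool → F → F
galois false γ = γ
galois true  γ = γ ^F 17

IsNonzeroSquare : F → Set
IsNonzeroSquare a = ∃[ c ] (c ≢ 0F × c *F c ≡ a)

-- Aut(P(17²)) : maps γ ↦ a γ^v + b with a a nonzero square
record Aut : Set where
  constructor aut
  field
    a   : F
    a-sq : IsNonzeroSquare a
    b   : F
    v   : Bool

⟦_⟧ : Aut → F → F
⟦ aut a _ b v ⟧ γ = a *F galois v γ +F b

Subset : Set₁
Subset = Pred F 0ℓ

_[_] : Aut → Subset → Subset
(σ [ S ]) y = ∃[ x ] (S x × ⟦ σ ⟧ x ≡ y)

listSet : List F → Subset
listSet xs y = y ∈ xs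

C : Subset
C = listSet
  ( 0F
  ∷ embed ⟨ 1 ⟩ ∷ embed ⟨ 4 ⟩ ∷ embed ⟨ 16 ⟩ ∷ embed ⟨ 13 ⟩
  ∷ (α +F embed ⟨ 7 ⟩) *F embed ⟨ 1 ⟩
  ∷ (α +F embed ⟨ 7 ⟩) *F embed ⟨ 4 ⟩
  ∷ (α +F embed ⟨ 10 ⟩) *F embed ⟨ 1 ⟩
  ∷ (α +F embed ⟨ 10 ⟩) *F embed ⟨ 4 ⟩
  ∷ [])

φ′ : F → F
φ′ γ = embed ⟨ 16 ⟩ *F (γ ^F 17)

{-# OPTIONS --safe #-}
-- An automorphism σ(γ) = aγ^v + b that sends C into C has b = σ(0) ∈ C and a + b = σ(1) ∈ C.
-- This leaves 9 · 9 · 2 candidates, and evaluating them on C shows that only the identity and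
-- φ′ survive; φ′ is an involution preserving C, so the stabiliser is {id, φ′}.
-- For the orbit, every σ with v = Frobenius equals (γ ↦ 16aγ + b) ∘ φ′ and so has the same image
-- of C, hence the maps γ ↦ aγ + b already sweep out the orbit. Two of them have the same image only
-- if one composed with the inverse of the other stabilises C, i.e. only if they coincide. So the
-- orbit is indexed by the 144 nonzero squares a, written c² with c running over 𝔽*/{±1}, and the
-- 289 translations b: 144 · 289 = 41616.
module Submission where

open import Defs

open import Algebra.Bundles using (CommutativeRing; CancellativeCommutativeSemiring)
open import Algebra.Consequences.Propositional
  using (comm∧idˡ⇒idʳ; comm∧invˡ⇒invʳ; comm∧distrʳ⇒distrˡ)
open import Algebra.Core using (Op₁; Op₂)
open import Algebra.Definitions
import Algebra.Properties.CancellativeCommutativeSemiring as CancellativeSemiringProperties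
import Algebra.Properties.CommutativeSemigroup as CommutativeSemigroupProperties
import Algebra.Properties.Group as GroupProperties
import Algebra.Properties.Ring as RingProperties
import Algebra.Solver.Ring.NaturalCoefficients.Default as NaturalCoefficientSolver
open import Algebra.Structures using (IsCommutativeRing)
open import Data.Bool using (Bool; true; false; if_then_else_) renaming (_≟_ to _≟ᴮ_)
open import Data.Fin using (Fin; toℕ; zero; suc)
open import Data.Fin.Properties using (toℕ-injective; toℕ-fromℕ<; toℕ<n; toℕ≤n; all?; *↔×)
  renaming (_≟_ to _≟₁₇_)
open import Data.List using (List; []; _∷_)
open import Data.List.Membership.Propositional using (_∈_)
open import Data.List.Relation.Unary.All as All using (All)
open import Data.List.Relation.Unary.Any using (here; there)
import Data.Nat as ℕ
open import Data.Nat using (ℕ; suc; _∸_; _≤ᵇ_)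
open import Data.Nat.DivMod using (_mod_; _%_; %-distribˡ-+; %-distribˡ-*; m<n⇒m%n≡m; n%n≡0)
import Data.Nat.Properties as ℕ
open import Data.Product using (_×_; _,_; ∃-syntax; Σ-syntax; proj₁; proj₂; curry; uncurry)
open import Data.Product.Function.NonDependent.Propositional using (_×-↔_)
open import Data.Product.Properties using (≡-dec; ,-injectiveˡ; ,-injectiveʳ)
open import Data.Sum using (_⊎_; inj₁; inj₂; [_,_]′)
import Data.Sum as Sum
open import Function using (id; _∘_)
open import Function.Bundles using (_⇔_; _↔_; Inverse; Injection; mk⇔)
open import Function.Construct.Composition using (_↔-∘_)
open import Function.Properties.Inverse using (↔⇒↣)
open import Level using (0ℓ)
open import Relation.Binary.Definitions using (Decidable; DecidableEquality)
open import Relation.Binary.PropositionalEquality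
  using (_≡_; _≢_; refl; sym; trans; cong; cong₂; subst; isEquivalence; _≗_; module ≡-Reasoning)
open import Relation.Nullary using (Dec; contradiction)
open import Relation.Nullary.Decidable using (map′; from-yes; _×-dec_; _⊎-dec_; _→-dec_; ¬?)
open import Relation.Unary using (Pred; _≐_)

-- Commutative rings ℤ/nℤ and R[√δ]

module _ {A : Set} {_+_ _*_ : Op₂ A} { -_ : Op₁ A} {0# 1# : A} where

  isCommutativeRingˡ :
    Associative _≡_ _+_ → Commutative _≡_ _+_ → LeftIdentity _≡_ 0# _+_ → LeftInverse _≡_ 0# -_ _+_ →
    Associative _≡_ _*_ → Commutative _≡_ _*_ → LeftIdentity _≡_ 1# _*_ → _DistributesOverʳ_ _≡_ _*_ _+_ →
    IsCommutativeRing _≡_ _+_ _*_ -_ 0# 1#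
  isCommutativeRingˡ +-assoc +-comm +-identityˡ -‿inverseˡ *-assoc *-comm *-identityˡ distribʳ = record
    { isRing = record
      { +-isAbelianGroup = record
        { isGroup = record
          { isMonoid = record
            { isSemigroup = record
              { isMagma = record { isEquivalence = isEquivalence ; ∙-cong = cong₂ _+_ }
              ; assoc = +-assoc
              }
            ; identity = +-identityˡ , comm∧idˡ⇒idʳ +-comm +-identityˡ
            }
          ; inverse = -‿inverseˡ , comm∧invˡ⇒invʳ +-comm -‿inverseˡ
          ; ⁻¹-cong = cong -_
          }
        ; comm = +-comm
        }
      ; *-cong = cong₂ _*_
      ; *-assoc = *-assoc
      ; *-identity = *-identityˡ , comm∧idˡ⇒idʳ *-comm *-identityˡ
      ; distrib = comm∧distrʳ⇒distrˡ *-comm distribʳ , distribʳ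
      }
    ; *-comm = *-comm
    }

-- ℤ/(n+1)ℤ, so that the modulus is visibly nonzero.
module ℤMod (n : ℕ) where

  ⌊_⌋ : ℕ → Fin (suc n)
  ⌊ m ⌋ = m mod suc n

  infixl 6 _+_
  infixl 7 _*_
  infix 8 -_

  _+_ _*_ : Op₂ (Fin (suc n))
  x + y = ⌊ toℕ x ℕ.+ toℕ y ⌋
  x * y = ⌊ toℕ x ℕ.* toℕ y ⌋

  -_ : Op₁ (Fin (suc n))
  - x = ⌊ suc n ∸ toℕ x ⌋

  0# 1# : Fin (suc n)
  0# = ⌊ 0 ⌋
  1# = ⌊ 1 ⌋

  toℕ-⌊⌋ : ∀ m → toℕ ⌊ m ⌋ ≡ m % suc n
  toℕ-⌊⌋ m = toℕ-fromℕ< _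

  ⌊⌋-cong-% : ∀ m k → m % suc n ≡ k % suc n → ⌊ m ⌋ ≡ ⌊ k ⌋
  ⌊⌋-cong-% m k eq = toℕ-injective (trans (toℕ-⌊⌋ m) (trans eq (sym (toℕ-⌊⌋ k))))

  ⌊toℕ⌋ : ∀ x → ⌊ toℕ x ⌋ ≡ x
  ⌊toℕ⌋ x = toℕ-injective (trans (toℕ-⌊⌋ (toℕ x)) (m<n⇒m%n≡m (toℕ<n x)))

  open ≡-Reasoning

  +-homo : ∀ m k → ⌊ m ⌋ + ⌊ k ⌋ ≡ ⌊ m ℕ.+ k ⌋
  +-homo m k = ⌊⌋-cong-% (toℕ ⌊ m ⌋ ℕ.+ toℕ ⌊ k ⌋) (m ℕ.+ k) (begin
    (toℕ ⌊ m ⌋ ℕ.+ toℕ ⌊ k ⌋) % suc n   ≡⟨ cong₂ (λ a b → (a ℕ.+ b) % suc n) (toℕ-⌊⌋ m) (toℕ-⌊⌋ k) ⟩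
    (m % suc n ℕ.+ k % suc n) % suc n   ≡⟨ %-distribˡ-+ m k (suc n) ⟨
    (m ℕ.+ k) % suc n                   ∎)

  *-homo : ∀ m k → ⌊ m ⌋ * ⌊ k ⌋ ≡ ⌊ m ℕ.* k ⌋
  *-homo m k = ⌊⌋-cong-% (toℕ ⌊ m ⌋ ℕ.* toℕ ⌊ k ⌋) (m ℕ.* k) (begin
    (toℕ ⌊ m ⌋ ℕ.* toℕ ⌊ k ⌋) % suc n   ≡⟨ cong₂ (λ a b → (a ℕ.* b) % suc n) (toℕ-⌊⌋ m) (toℕ-⌊⌋ k) ⟩
    (m % suc n ℕ.* (k % suc n)) % suc n ≡⟨ %-distribˡ-* m k (suc n) ⟨
    (m ℕ.* k) % suc n                   ∎)

  +-homoˡ : ∀ m y → ⌊ m ⌋ + y ≡ ⌊ m ℕ.+ toℕ y ⌋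
  +-homoˡ m y = trans (cong (⌊ m ⌋ +_) (sym (⌊toℕ⌋ y))) (+-homo m (toℕ y))

  +-homoʳ : ∀ x k → x + ⌊ k ⌋ ≡ ⌊ toℕ x ℕ.+ k ⌋
  +-homoʳ x k = trans (cong (_+ ⌊ k ⌋) (sym (⌊toℕ⌋ x))) (+-homo (toℕ x) k)

  *-homoˡ : ∀ m y → ⌊ m ⌋ * y ≡ ⌊ m ℕ.* toℕ y ⌋
  *-homoˡ m y = trans (cong (⌊ m ⌋ *_) (sym (⌊toℕ⌋ y))) (*-homo m (toℕ y))

  *-homoʳ : ∀ x k → x * ⌊ k ⌋ ≡ ⌊ toℕ x ℕ.* k ⌋
  *-homoʳ x k = trans (cong (_* ⌊ k ⌋) (sym (⌊toℕ⌋ x))) (*-homo (toℕ x) k)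

  +-assoc : Associative _≡_ _+_
  +-assoc x y z = begin
    ⌊ toℕ x ℕ.+ toℕ y ⌋ + z              ≡⟨ +-homoˡ (toℕ x ℕ.+ toℕ y) z ⟩
    ⌊ toℕ x ℕ.+ toℕ y ℕ.+ toℕ z ⌋        ≡⟨ cong ⌊_⌋ (ℕ.+-assoc (toℕ x) (toℕ y) (toℕ z)) ⟩
    ⌊ toℕ x ℕ.+ (toℕ y ℕ.+ toℕ z) ⌋      ≡⟨ +-homoʳ x (toℕ y ℕ.+ toℕ z) ⟨
    x + ⌊ toℕ y ℕ.+ toℕ z ⌋              ∎

  +-comm : Commutative _≡_ _+_
  +-comm x y = cong ⌊_⌋ (ℕ.+-comm (toℕ x) (toℕ y))

  +-identityˡ : LeftIdentity _≡_ 0# _+_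
  +-identityˡ x = trans (+-homoˡ 0 x) (⌊toℕ⌋ x)

  -‿inverseˡ : LeftInverse _≡_ 0# -_ _+_
  -‿inverseˡ x = begin
    ⌊ suc n ∸ toℕ x ⌋ + x                ≡⟨ +-homoˡ (suc n ∸ toℕ x) x ⟩
    ⌊ suc n ∸ toℕ x ℕ.+ toℕ x ⌋          ≡⟨ cong ⌊_⌋ (ℕ.m∸n+n≡m (toℕ≤n x)) ⟩
    ⌊ suc n ⌋                            ≡⟨ ⌊⌋-cong-% (suc n) 0 (n%n≡0 (suc n)) ⟩
    0#                                   ∎

  *-assoc : Associative _≡_ _*_
  *-assoc x y z = begin
    ⌊ toℕ x ℕ.* toℕ y ⌋ * z              ≡⟨ *-homoˡ (toℕ x ℕ.* toℕ y) z ⟩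
    ⌊ toℕ x ℕ.* toℕ y ℕ.* toℕ z ⌋        ≡⟨ cong ⌊_⌋ (ℕ.*-assoc (toℕ x) (toℕ y) (toℕ z)) ⟩
    ⌊ toℕ x ℕ.* (toℕ y ℕ.* toℕ z) ⌋      ≡⟨ *-homoʳ x (toℕ y ℕ.* toℕ z) ⟨
    x * ⌊ toℕ y ℕ.* toℕ z ⌋              ∎

  *-comm : Commutative _≡_ _*_
  *-comm x y = cong ⌊_⌋ (ℕ.*-comm (toℕ x) (toℕ y))

  *-identityˡ : LeftIdentity _≡_ 1# _*_
  *-identityˡ x = trans (*-homoˡ 1 x) (trans (cong ⌊_⌋ (ℕ.*-identityˡ (toℕ x))) (⌊toℕ⌋ x))

  *-distribʳ-+ : _DistributesOverʳ_ _≡_ _*_ _+_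
  *-distribʳ-+ z x y = begin
    ⌊ toℕ x ℕ.+ toℕ y ⌋ * z                     ≡⟨ *-homoˡ (toℕ x ℕ.+ toℕ y) z ⟩
    ⌊ (toℕ x ℕ.+ toℕ y) ℕ.* toℕ z ⌋             ≡⟨ cong ⌊_⌋ (ℕ.*-distribʳ-+ (toℕ z) (toℕ x) (toℕ y)) ⟩
    ⌊ toℕ x ℕ.* toℕ z ℕ.+ toℕ y ℕ.* toℕ z ⌋     ≡⟨ +-homo (toℕ x ℕ.* toℕ z) (toℕ y ℕ.* toℕ z) ⟨
    x * z + y * z                               ∎

  isCommutativeRing : IsCommutativeRing _≡_ _+_ _*_ -_ 0# 1#
  isCommutativeRing = isCommutativeRingˡ
    +-assoc +-comm +-identityˡ -‿inverseˡ *-assoc *-comm *-identityˡ *-distribʳ-+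

module QuadraticExtension {A : Set} {add mul : Op₂ A} {neg : Op₁ A} {0ᴬ 1ᴬ : A}
  (isCommutativeRing : IsCommutativeRing _≡_ add mul neg 0ᴬ 1ᴬ) (δ : A) where

  private
    R : CommutativeRing 0ℓ 0ℓ
    R = record { isCommutativeRing = isCommutativeRing }

  open CommutativeRing R
    using (_+_; _*_; -_; 0#; 1#; +-assoc; +-comm; +-identityˡ; +-identityʳ; -‿inverseˡ;
           *-identityˡ; zeroˡ; zeroʳ; commutativeSemiring)
  open NaturalCoefficientSolver commutativeSemiring using (solve; _:=_; _:+_; _:*_; Polynomial)

  -- Stated over an arbitrary carrier so that the same definition also multiplies the solver's polynomials.
  product : ∀ {B : Set} → Op₂ B → Op₂ B → B → Op₂ (B × B)
  product _⊞_ _⊠_ d (x₁ , y₁) (x₂ , y₂) = ((x₁ ⊠ x₂) ⊞ (d ⊠ (y₁ ⊠ y₂))) , ((x₁ ⊠ y₂) ⊞ (y₁ ⊠ x₂))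

  infixl 6 _+ᴱ_
  infixl 7 _*ᴱ_

  _+ᴱ_ _*ᴱ_ : Op₂ (A × A)
  (x₁ , y₁) +ᴱ (x₂ , y₂) = (x₁ + x₂) , (y₁ + y₂)
  _*ᴱ_ = product _+_ _*_ δ

  -ᴱ_ : Op₁ (A × A)
  -ᴱ (x , y) = (- x) , (- y)

  0ᴱ 1ᴱ : A × A
  0ᴱ = 0# , 0#
  1ᴱ = 1# , 0#

  -- The solver only has natural-number coefficients, so δ enters these identities as a variable.
  private
    infixl 7 _⊛⟨_⟩_
    _⊛⟨_⟩_ : ∀ {n} → Polynomial n × Polynomial n → Polynomial n → Polynomial n × Polynomial n →
             Polynomial n × Polynomial n
    p ⊛⟨ d ⟩ q = product _:+_ _:*_ d p q

  *ᴱ-assoc : Associative _≡_ _*ᴱ_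
  *ᴱ-assoc (a , b) (c , d) (e , f) = cong₂ _,_
    (solve 7 (λ δ a b c d e f → proj₁ ((a , b) ⊛⟨ δ ⟩ (c , d) ⊛⟨ δ ⟩ (e , f))
                             := proj₁ ((a , b) ⊛⟨ δ ⟩ ((c , d) ⊛⟨ δ ⟩ (e , f)))) refl δ a b c d e f)
    (solve 7 (λ δ a b c d e f → proj₂ ((a , b) ⊛⟨ δ ⟩ (c , d) ⊛⟨ δ ⟩ (e , f))
                             := proj₂ ((a , b) ⊛⟨ δ ⟩ ((c , d) ⊛⟨ δ ⟩ (e , f)))) refl δ a b c d e f)

  *ᴱ-comm : Commutative _≡_ _*ᴱ_
  *ᴱ-comm (a , b) (c , d) = cong₂ _,_
    (solve 5 (λ δ a b c d → proj₁ ((a , b) ⊛⟨ δ ⟩ (c , d)) := proj₁ ((c , d) ⊛⟨ δ ⟩ (a , b))) refl δ a b c d)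
    (solve 5 (λ δ a b c d → proj₂ ((a , b) ⊛⟨ δ ⟩ (c , d)) := proj₂ ((c , d) ⊛⟨ δ ⟩ (a , b))) refl δ a b c d)

  *ᴱ-identityˡ : LeftIdentity _≡_ 1ᴱ _*ᴱ_
  *ᴱ-identityˡ (x , y) = cong₂ _,_
    (trans (cong₂ _+_ (*-identityˡ x) (trans (cong (δ *_) (zeroˡ y)) (zeroʳ δ))) (+-identityʳ x))
    (trans (cong₂ _+_ (*-identityˡ y) (zeroˡ x)) (+-identityʳ y))

  *ᴱ-distribʳ-+ᴱ : _DistributesOverʳ_ _≡_ _*ᴱ_ _+ᴱ_
  *ᴱ-distribʳ-+ᴱ (a , b) (c , d) (e , f) = cong₂ _,_
    (solve 7 (λ δ a b c d e f → proj₁ ((c :+ e , d :+ f) ⊛⟨ δ ⟩ (a , b))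
                             := proj₁ ((c , d) ⊛⟨ δ ⟩ (a , b)) :+ proj₁ ((e , f) ⊛⟨ δ ⟩ (a , b))) refl δ a b c d e f)
    (solve 7 (λ δ a b c d e f → proj₂ ((c :+ e , d :+ f) ⊛⟨ δ ⟩ (a , b))
                             := proj₂ ((c , d) ⊛⟨ δ ⟩ (a , b)) :+ proj₂ ((e , f) ⊛⟨ δ ⟩ (a , b))) refl δ a b c d e f)

  isCommutativeRingᴱ : IsCommutativeRing _≡_ _+ᴱ_ _*ᴱ_ -ᴱ_ 0ᴱ 1ᴱ
  isCommutativeRingᴱ = isCommutativeRingˡ
    (λ (a , b) (c , d) (e , f) → cong₂ _,_ (+-assoc a c e) (+-assoc b d f))
    (λ (a , b) (c , d) → cong₂ _,_ (+-comm a c) (+-comm b d))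
    (λ (a , b) → cong₂ _,_ (+-identityˡ a) (+-identityˡ b))
    (λ (a , b) → cong₂ _,_ (-‿inverseˡ a) (-‿inverseˡ b))
    *ᴱ-assoc *ᴱ-comm *ᴱ-identityˡ *ᴱ-distribʳ-+ᴱ

  commutativeRingᴱ : CommutativeRing 0ℓ 0ℓ
  commutativeRingᴱ = record { isCommutativeRing = isCommutativeRingᴱ }

module SquareProperties {c ℓ} (R : CommutativeRing c ℓ) where

  open CommutativeRing R hiding (isEquivalence) renaming (refl to ≈-refl; sym to ≈-sym; trans to ≈-trans)
  open RingProperties ring using (-‿distribˡ-*; -‿distribʳ-*; -‿involutive)
  open GroupProperties +-group using (x∙y⁻¹≈ε⇒x≈y; x≈y⇒x∙y⁻¹≈ε; inverseˡ-unique; //-rightDividesʳ)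
  open NaturalCoefficientSolver commutativeSemiring using (solve; _:=_; _:+_; _:*_)
  open import Relation.Binary.Reasoning.Setoid setoid

  -x*-x≈x*x : ∀ x → - x * - x ≈ x * x
  -x*-x≈x*x x = begin
    - x * - x     ≈⟨ -‿distribˡ-* x (- x) ⟨
    - (x * - x)   ≈⟨ -‿cong (-‿distribʳ-* x x) ⟨
    - - (x * x)   ≈⟨ -‿involutive (x * x) ⟩
    x * x         ∎

  [x-y][x+y]≈x²-y² : ∀ x y → (x + - y) * (x + y) ≈ x * x + - (y * y)
  [x-y][x+y]≈x²-y² x y = begin
    (x + - y) * (x + y)                     ≈⟨ expand ⟩
    x * x + - y * y + (- y * x + x * y)     ≈⟨ +-congʳ (+-congˡ (-‿distribˡ-* y y)) ⟨
    x * x + - (y * y) + (- y * x + x * y)   ≈⟨ +-congˡ cancel ⟩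
    x * x + - (y * y) + 0#                  ≈⟨ +-identityʳ _ ⟩
    x * x + - (y * y)                       ∎
    where
    expand : (x + - y) * (x + y) ≈ x * x + - y * y + (- y * x + x * y)
    expand = solve 3 (λ x y n → (x :+ n) :* (x :+ y) := x :* x :+ n :* y :+ (n :* x :+ x :* y)) ≈-refl x y (- y)
    cancel : - y * x + x * y ≈ 0#
    cancel = ≈-trans (+-congʳ (≈-trans (≈-sym (-‿distribˡ-* y x)) (-‿cong (*-comm y x)))) (-‿inverseˡ (x * y))

  module WithInverses (_≟_ : Decidable _≈_) (_⁻¹ : Op₁ Carrier)
                      (⁻¹-inverseʳ : ∀ {x} → x ≉ 0# → x * x ⁻¹ ≈ 1#) where

    ⁻¹-cancelˡ : ∀ {x} y → x ≉ 0# → x ⁻¹ * (x * y) ≈ y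
    ⁻¹-cancelˡ {x} y x≉0 = begin
      x ⁻¹ * (x * y) ≈⟨ *-assoc (x ⁻¹) x y ⟨
      x ⁻¹ * x * y   ≈⟨ *-congʳ (≈-trans (*-comm (x ⁻¹) x) (⁻¹-inverseʳ x≉0)) ⟩
      1# * y         ≈⟨ *-identityˡ y ⟩
      y              ∎

    u⁻¹x≈y⇒x≈uy : ∀ {u x y} → u ≉ 0# → u ⁻¹ * x ≈ y → x ≈ u * y
    u⁻¹x≈y⇒x≈uy {u} {x} {y} u≉0 u⁻¹x≈y = begin
      x              ≈⟨ ⁻¹-cancelˡ x u≉0 ⟨
      u ⁻¹ * (u * x) ≈⟨ *-congˡ (*-comm u x) ⟩
      u ⁻¹ * (x * u) ≈⟨ *-assoc (u ⁻¹) x u ⟨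
      u ⁻¹ * x * u   ≈⟨ *-congʳ u⁻¹x≈y ⟩
      y * u          ≈⟨ *-comm y u ⟩
      u * y          ∎

    cancellativeCommutativeSemiring : CancellativeCommutativeSemiring c ℓ
    cancellativeCommutativeSemiring = record
      { isCancellativeCommutativeSemiring = record
        { isCommutativeSemiring = isCommutativeSemiring
        ; *-cancelˡ-nonZero = λ x y z x≉0 xy≈xz →
            ≈-trans (≈-sym (⁻¹-cancelˡ y x≉0)) (≈-trans (*-congˡ xy≈xz) (⁻¹-cancelˡ z x≉0))
        }
      }

    open CancellativeSemiringProperties cancellativeCommutativeSemiring public
      using (xy≈0⇒x≈0∨y≈0; x≉0∧y≉0⇒xy≉0)

    x*x≈y*y⇒x≈±y : ∀ {x y} → x * x ≈ y * y → x ≈ y ⊎ x ≈ - y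
    x*x≈y*y⇒x≈±y {x} {y} eq = Sum.map (x∙y⁻¹≈ε⇒x≈y x y) (inverseˡ-unique x y)
      (xy≈0⇒x≈0∨y≈0 _≟_ (≈-trans ([x-y][x+y]≈x²-y² x y) (x≈y⇒x∙y⁻¹≈ε eq)))

    affine-solve : ∀ {u w a b x y} → u ≉ 0# → u * y + w ≈ a * x + b →
                   y ≈ u ⁻¹ * a * x + u ⁻¹ * (b + - w)
    affine-solve {u} {w} {a} {b} {x} {y} u≉0 eq = begin
      y                                 ≈⟨ ⁻¹-cancelˡ y u≉0 ⟨
      u ⁻¹ * (u * y)                    ≈⟨ *-congˡ (//-rightDividesʳ w (u * y)) ⟨
      u ⁻¹ * (u * y + w + - w)          ≈⟨ *-congˡ (+-congʳ eq) ⟩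
      u ⁻¹ * (a * x + b + - w)          ≈⟨ *-congˡ (+-assoc (a * x) b (- w)) ⟩
      u ⁻¹ * (a * x + (b + - w))        ≈⟨ distribˡ (u ⁻¹) (a * x) (b + - w) ⟩
      u ⁻¹ * (a * x) + u ⁻¹ * (b + - w) ≈⟨ +-congʳ (*-assoc (u ⁻¹) a x) ⟨
      u ⁻¹ * a * x + u ⁻¹ * (b + - w)   ∎

module ℤ/17 = ℤMod 16

𝔽-commutativeRing : CommutativeRing 0ℓ 0ℓ
𝔽-commutativeRing = QuadraticExtension.commutativeRingᴱ ℤ/17.isCommutativeRing δ

module 𝔽 = CommutativeRing 𝔽-commutativeRing

infix 4 _≟F_
_≟F_ : DecidableEquality F
_≟F_ = ≡-dec _≟₁₇_ _≟₁₇_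

all?-× : ∀ {m n p} {P : Pred (Fin m × Fin n) p} → (∀ ij → Dec (P ij)) → Dec (∀ ij → P ij)
all?-× P? = map′ uncurry curry (all? λ i → all? λ j → P? (i , j))

all?-Bool : ∀ {p} {P : Pred Bool p} → (∀ v → Dec (P v)) → Dec (∀ v → P v)
all?-Bool P? = map′ (λ (p , q) → λ { false → p ; true → q }) (λ h → h false , h true) (P? false ×-dec P? true)

conj : F → F
conj (x , y) = x , ℤ/17.- y

-- γ · conj γ is the norm of γ, which lies in 𝔽₁₇, where t⁻¹ = t¹⁵. Opaque, because unfolding
-- the fifteenth power while comparing terms is prohibitively expensive.
opaque
  infix 8 _⁻¹
  _⁻¹ : F → F
  γ ⁻¹ = (γ *F conj γ) ^F 15 *F conj γ

  ⁻¹-inverseʳ : ∀ {γ} → γ ≢ 0F → γ *F γ ⁻¹ ≡ 1F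
  ⁻¹-inverseʳ {γ} = from-yes (all?-× λ γ → ¬? (γ ≟F 0F) →-dec γ *F γ ⁻¹ ≟F 1F) γ

open SquareProperties 𝔽-commutativeRing using (-x*-x≈x*x)
open SquareProperties.WithInverses 𝔽-commutativeRing _≟F_ _⁻¹ ⁻¹-inverseʳ
  using (x≉0∧y≉0⇒xy≉0; x*x≈y*y⇒x≈±y; affine-solve; u⁻¹x≈y⇒x≈uy)
open GroupProperties 𝔽.+-group using (//-rightDividesʳ; x∙y⁻¹≈ε⇒x≈y)
open CommutativeSemigroupProperties 𝔽.*-commutativeSemigroup using (interchange)

4F 16F : F
4F  = embed ⟨ 4 ⟩
16F = embed ⟨ 16 ⟩

IsNonzeroSquare⇒≢0 : ∀ {a} → IsNonzeroSquare a → a ≢ 0F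
IsNonzeroSquare⇒≢0 (c , c≢0 , refl) = x≉0∧y≉0⇒xy≉0 _≟F_ c≢0 c≢0

-- The stabiliser of C

C-list : List F
C-list = 0F
  ∷ embed ⟨ 1 ⟩ ∷ embed ⟨ 4 ⟩ ∷ embed ⟨ 16 ⟩ ∷ embed ⟨ 13 ⟩
  ∷ (α +F embed ⟨ 7 ⟩) *F embed ⟨ 1 ⟩
  ∷ (α +F embed ⟨ 7 ⟩) *F embed ⟨ 4 ⟩
  ∷ (α +F embed ⟨ 10 ⟩) *F embed ⟨ 1 ⟩
  ∷ (α +F embed ⟨ 10 ⟩) *F embed ⟨ 4 ⟩
  ∷ []

MapsCIntoC : (F → F) → Set
MapsCIntoC f = All (λ x → f x ∈ C-list) C-list

mapsCIntoC? : ∀ f → Dec (MapsCIntoC f)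
mapsCIntoC? f = All.all? (λ x → f x ∈? C-list) C-list
  where open import Data.List.Membership.DecPropositional _≟F_ using (_∈?_)

φ′-maps-C-into-C : ∀ {x} → C x → C (φ′ x)
φ′-maps-C-into-C = All.lookup (from-yes (mapsCIntoC? φ′))

φ′-involutive : ∀ γ → φ′ (φ′ γ) ≡ γ
φ′-involutive = from-yes (all?-× λ γ → φ′ (φ′ γ) ≟F γ)

semiaffine : F → F → Bool → F → F
semiaffine a b v γ = a *F galois v γ +F b

IsIdentityOrφ′ : F → F → Bool → Set
IsIdentityOrφ′ a b v = (a , b , v) ≡ (1F , 0F , false) ⊎ (a , b , v) ≡ (16F , 0F , true)

isIdentityOrφ′? : ∀ a b v → Dec (IsIdentityOrφ′ a b v)
isIdentityOrφ′? a b v = (a , b , v) ≟ (1F , 0F , false) ⊎-dec (a , b , v) ≟ (16F , 0F , true)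
  where _≟_ = ≡-dec _≟F_ (≡-dec _≟F_ _≟ᴮ_)

stabiliser-candidates :
  All (λ d → All (λ b → ∀ v → MapsCIntoC (semiaffine (d +F 𝔽.- b) b v) →
                              d +F 𝔽.- b ≡ 0F ⊎ IsIdentityOrφ′ (d +F 𝔽.- b) b v)
                 C-list)
      C-list
stabiliser-candidates = from-yes (All.all? (λ d → All.all? (λ b → all?-Bool λ v →
  mapsCIntoC? (semiaffine (d +F 𝔽.- b) b v) →-dec
    (d +F 𝔽.- b ≟F 0F ⊎-dec isIdentityOrφ′? (d +F 𝔽.- b) b v)) C-list) C-list)

MapsCIntoC⇒IsIdentityOrφ′ : ∀ {a b v} → a ≢ 0F → MapsCIntoC (semiaffine a b v) → IsIdentityOrφ′ a b v
MapsCIntoC⇒IsIdentityOrφ′ {a} {b} {v} a≢0 maps =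
  [ (λ a≡0 → contradiction a≡0 a≢0) , id ]′
    (subst (λ a′ → a′ ≡ 0F ⊎ IsIdentityOrφ′ a′ b v) a+b-b≡a
      (All.lookup (All.lookup stabiliser-candidates a+b∈C) b∈C v
        (subst (λ a′ → MapsCIntoC (semiaffine a′ b v)) (sym a+b-b≡a) maps)))
  where
  a+b-b≡a : a +F b +F 𝔽.- b ≡ a
  a+b-b≡a = //-rightDividesʳ b a
  galois-0F : ∀ v → galois v 0F ≡ 0F
  galois-0F false = refl
  galois-0F true  = refl
  galois-1F : ∀ v → galois v 1F ≡ 1F
  galois-1F false = refl
  galois-1F true  = refl
  b∈C : b ∈ C-list
  b∈C = subst (_∈ C-list)
    (trans (cong (λ z → a *F z +F b) (galois-0F v)) (trans (cong (_+F b) (𝔽.zeroʳ a)) (𝔽.+-identityˡ b)))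
    (All.lookup maps (here refl))
  a+b∈C : a +F b ∈ C-list
  a+b∈C = subst (_∈ C-list)
    (trans (cong (λ z → a *F z +F b) (galois-1F v)) (cong (_+F b) (𝔽.*-identityʳ a)))
    (All.lookup maps (there (here refl)))

IsIdentityOrφ′⇒≗ : ∀ {a b v} → IsIdentityOrφ′ a b v → semiaffine a b v ≗ id ⊎ semiaffine a b v ≗ φ′
IsIdentityOrφ′⇒≗ (inj₁ refl) = inj₁ λ γ → trans (𝔽.+-identityʳ _) (𝔽.*-identityˡ γ)
IsIdentityOrφ′⇒≗ (inj₂ refl) = inj₂ λ γ → 𝔽.+-identityʳ _

image-≐-self : ∀ {σ : Aut} {f : F → F} {S : Subset} → ⟦ σ ⟧ ≗ f →
               (∀ {x} → S x → S (f x)) → (∀ x → f (f x) ≡ x) → σ [ S ] ≐ S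
image-≐-self {S = S} σ≗f f-maps f-involutive =
  (λ (x , x∈S , σx≡y) → subst S (trans (sym (σ≗f x)) σx≡y) (f-maps x∈S)) ,
  (λ {y} y∈S → _ , f-maps y∈S , trans (σ≗f _) (f-involutive y))

stabiliser : ∀ σ → σ [ C ] ≐ C ⇔ (⟦ σ ⟧ ≗ id ⊎ ⟦ σ ⟧ ≗ φ′)
stabiliser σ@(aut a a-square b v) = mk⇔
  (λ σ[C]≐C → IsIdentityOrφ′⇒≗ (MapsCIntoC⇒IsIdentityOrφ′ {a} {b} {v} (IsNonzeroSquare⇒≢0 a-square)
                 (All.tabulate λ x∈C → proj₁ σ[C]≐C (_ , x∈C , refl))))
  [ (λ σ≗id → image-≐-self {σ} σ≗id id λ _ → refl)
  , (λ σ≗φ′ → image-≐-self {σ} σ≗φ′ φ′-maps-C-into-C φ′-involutive)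
  ]′

-- The orbit of C

affine-C⊆affine-C⇒≡ : ∀ {a b u w} → a ≢ 0F → u ≢ 0F →
                      (∀ {x} → C x → ∃[ y ] (C y × u *F y +F w ≡ a *F x +F b)) → a ≡ u × b ≡ w
affine-C⊆affine-C⇒≡ {a} {b} {u} {w} a≢0 u≢0 ⊆ = a≡u , b≡w
  where
  A B : F
  A = u ⁻¹ *F a
  B = u ⁻¹ *F (b +F 𝔽.- w)
  maps : MapsCIntoC (semiaffine A B false)
  maps = All.tabulate λ x∈C → let (y , y∈C , eq) = ⊆ x∈C in subst (_∈ C-list) (affine-solve u≢0 eq) y∈C
  A≢0 : A ≢ 0F
  A≢0 A≡0 = a≢0 (trans (u⁻¹x≈y⇒x≈uy u≢0 A≡0) (𝔽.zeroʳ u))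
  A,B≡1,0 : (A , B) ≡ (1F , 0F)
  A,B≡1,0 = [ cong (λ (a , b , _) → a , b) , (λ eq → contradiction (cong (proj₂ ∘ proj₂) eq) λ ()) ]′
              (MapsCIntoC⇒IsIdentityOrφ′ {v = false} A≢0 maps)
  a≡u : a ≡ u
  a≡u = trans (u⁻¹x≈y⇒x≈uy u≢0 (,-injectiveˡ A,B≡1,0)) (𝔽.*-identityʳ u)
  b≡w : b ≡ w
  b≡w = x∙y⁻¹≈ε⇒x≈y b w (trans (u⁻¹x≈y⇒x≈uy u≢0 (,-injectiveʳ A,B≡1,0)) (𝔽.zeroʳ u))

SignClass : Set
SignClass = Fin 8 × Fin 18

-- Representatives of 𝔽*/{±1}: the elements whose first nonzero coordinate lies in {1, …, 8}.
representative : SignClass → F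
representative (l , zero)  = ⟨ 0 ⟩ , ⟨ suc (toℕ l) ⟩
representative (l , suc y) = ⟨ suc (toℕ l) ⟩ , y

magnitude : F17 → Fin 8
magnitude t = if toℕ t ≤ᵇ 8 then (toℕ t ∸ 1) mod 8 else (16 ∸ toℕ t) mod 8

signClass : F → SignClass
signClass (zero , y)      = magnitude y , zero
signClass (x@(suc _) , y) = magnitude x , suc (if toℕ x ≤ᵇ 8 then y else ℤ/17.- y)

representative-≢0 : ∀ i → representative i ≢ 0F
representative-≢0 = from-yes (all?-× λ i → ¬? (representative i ≟F 0F))

signClass-representative : ∀ i → signClass (representative i) ≡ i
signClass-representative = from-yes (all?-× λ i → ≡-dec _≟₁₇_ _≟₁₇_ (signClass (representative i)) i)

signClass-neg : ∀ c → signClass (𝔽.- c) ≡ signClass c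
signClass-neg = from-yes (all?-× λ c → ≡-dec _≟₁₇_ _≟₁₇_ (signClass (𝔽.- c)) (signClass c))

representative-signClass : ∀ c → c ≢ 0F → representative (signClass c) ≡ c ⊎ representative (signClass c) ≡ 𝔽.- c
representative-signClass = from-yes (all?-× λ c → ¬? (c ≟F 0F) →-dec
  (representative (signClass c) ≟F c ⊎-dec representative (signClass c) ≟F 𝔽.- c))

square : SignClass → F
square i = representative i *F representative i

square-≢0 : ∀ i → square i ≢ 0F
square-≢0 i = x≉0∧y≉0⇒xy≉0 _≟F_ (representative-≢0 i) (representative-≢0 i)

square-injective : ∀ {i j} → square i ≡ square j → i ≡ j
square-injective {i} {j} eq = begin
  i                                 ≡⟨ signClass-representative i ⟨
  signClass (representative i)      ≡⟨ [ cong signClass , (λ rᵢ≡-rⱼ → trans (cong signClass rᵢ≡-rⱼ) (signClass-neg rⱼ)) ]′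
                                         (x*x≈y*y⇒x≈±y {representative i} {rⱼ} eq) ⟩
  signClass rⱼ                      ≡⟨ signClass-representative j ⟩
  j                                 ∎
  where
  open ≡-Reasoning
  rⱼ = representative j

square-signClass : ∀ {c} → c ≢ 0F → square (signClass c) ≡ c *F c
square-signClass {c} c≢0 =
  [ cong (λ z → z *F z) , (λ r≡-c → trans (cong (λ z → z *F z) r≡-c) (-x*-x≈x*x c)) ]′
    (representative-signClass c c≢0)

OrbitIndex : Set
OrbitIndex = SignClass × F

affineAut : OrbitIndex → Aut
affineAut (i , b) = aut (square i) (representative i , representative-≢0 i , refl) b false

image-≐-precompose : ∀ {σ τ : Aut} {π : F → F} {S : Subset} → (∀ {x} → S x → S (π x)) →
                     (∀ x → π (π x) ≡ x) → (∀ x → ⟦ σ ⟧ x ≡ ⟦ τ ⟧ (π x)) → σ [ S ] ≐ τ [ S ]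
image-≐-precompose {τ = τ} π-maps π-involutive σ≡τ∘π =
  (λ (x , x∈S , σx≡y) → _ , π-maps x∈S , trans (sym (σ≡τ∘π x)) σx≡y) ,
  (λ (x , x∈S , τx≡y) → _ , π-maps x∈S , trans (σ≡τ∘π _) (trans (cong ⟦ τ ⟧ (π-involutive x)) τx≡y))

affineAut-[C]-injective : ∀ {r s} → affineAut r [ C ] ≐ affineAut s [ C ] → r ≡ s
affineAut-[C]-injective {i , b} {j , w} (⊆ , _) = cong₂ _,_ (square-injective (proj₁ coefficients)) (proj₂ coefficients)
  where
  coefficients : square i ≡ square j × b ≡ w
  coefficients = affine-C⊆affine-C⇒≡ (square-≢0 i) (square-≢0 j) (λ x∈C → ⊆ (_ , x∈C , refl))

a*z≡16a*16z : ∀ a z → a *F z ≡ (16F *F a) *F (16F *F z)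
a*z≡16a*16z a z = begin
  a *F z                     ≡⟨ 𝔽.*-identityˡ (a *F z) ⟨
  (16F *F 16F) *F (a *F z)   ≡⟨ interchange 16F a 16F z ⟨
  (16F *F a) *F (16F *F z)   ∎
  where open ≡-Reasoning

-- The implicit arguments of image-≐-precompose are given explicitly: inferring them unfolds γ ^F 17.
affineAut-[C]-surjective : ∀ σ → ∃[ r ] (σ [ C ] ≐ affineAut r [ C ])
affineAut-[C]-surjective σ@(aut _ (c , c≢0 , refl) b false) =
  (signClass c , b) ,
  image-≐-precompose {σ} {affineAut (signClass c , b)} {id} {C} id (λ _ → refl)
    (λ x → cong (λ a → a *F x +F b) (sym (square-signClass c≢0)))
affineAut-[C]-surjective σ@(aut _ (c , c≢0 , refl) b true) =
  (signClass (4F *F c) , b) ,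
  image-≐-precompose {σ} {affineAut (signClass (4F *F c) , b)} {φ′} {C} φ′-maps-C-into-C φ′-involutive
    (λ x → cong (_+F b) (trans (a*z≡16a*16z (c *F c) (x ^F 17)) (cong (_*F φ′ x) 16c²≡square)))
  where
  16c²≡square : 16F *F (c *F c) ≡ square (signClass (4F *F c))
  16c²≡square = trans (sym (interchange 4F c 4F c))
                      (sym (square-signClass (x≉0∧y≉0⇒xy≉0 _≟F_ {4F} {c} (λ ()) c≢0)))

orbit-indexing : Fin 41616 ↔ OrbitIndex
orbit-indexing = (*↔× {8} {18} ×-↔ *↔× {17} {17}) ↔-∘ *↔× {144} {289}

lemma3p11 : (∃[ τ ] (∀ γ → ⟦ τ ⟧ γ ≡ φ′ γ))
    × (∃[ γ ] (φ′ γ ≢ γ))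
    × (∀ γ → φ′ (φ′ γ) ≡ γ)
    × (∀ (σ : Aut) → (σ [ C ] ≐ C) ⇔ ((∀ γ → ⟦ σ ⟧ γ ≡ γ) ⊎ (∀ γ → ⟦ σ ⟧ γ ≡ φ′ γ)))
    × (Σ[ f ∈ (Fin 41616 → Aut) ] (((i j : Fin 41616) → f i [ C ] ≐ f j [ C ] → i ≡ j)
               × (∀ (σ : Aut) → ∃[ i ] (σ [ C ] ≐ f i [ C ]))))
lemma3p11 =
  (aut 16F (4F , (λ ()) , refl) 0F true , λ γ → 𝔽.+-identityʳ _) ,
  (1F , λ ()) ,
  φ′-involutive ,
  stabiliser ,
  affineAut ∘ to ,
  (λ i j → Injection.injective (↔⇒↣ orbit-indexing) ∘ affineAut-[C]-injective {to i} {to j}) ,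
  λ σ → let (r , σ[C]≐r[C]) = affineAut-[C]-surjective σ in
        from r , subst (λ r → σ [ C ] ≐ affineAut r [ C ]) (sym (strictlyInverseˡ r)) σ[C]≐r[C]
  where open Inverse orbit-indexing using (to; from; strictlyInverseˡ)
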